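{- Let $M$, $X$, $e$, $f$, $B$, $C$, $A$, $M'$, $C'$, $A'$, $\omega$ be as in the context, and suppose $M'=M[I\,|\,C']$. Then neither $A$ nor $A^T$ has a submatrix of the form $\begin{bmatrix}x&y&z\end{bmatrix}$ where $x,y,z$ are distinct non-zero elements of $\mathrm{GF}(4)$.
   Context: $M$ is a $\mathrm{GF}(4)$-representable matroid on $E$ with a circuit-hyperplane $X$; $e\in X$ and $f\in E-X$ are such that $B=(X-e)\cup f$ is a basis of $M$; and $M=M[I\,|\,C]$ where $C$ is a matrix over $\mathrm{GF}(4)$ with rows indexed by $B$ and columns by $E-B$ of block form $C=\begin{bmatrix}A&\underline1\\ \underline1^T&0\end{bmatrix}$ (rows $X-e$, then $f$; columns $(E-X)-f$, then $e$; $\underline1$ all-ones). $M'$ is the matroid obtained from $M$ by relaxing $X$ (bases $\mathcal{B}(M)\cup\{X\}$), and $C'=\begin{bmatrix}A'&\underline1\\ \underline1^T&\omega\end{bmatrix}$ is a matrix over $\mathrm{GF}(4)$ with the same row and column labels, $A'$ an $(X-e)\times((E-X)-f)$ matrix and $\omega\in\mathrm{GF}(4)-\{0,1\}$. Here $M[I\,|\,C]$ is the vector matroid of $[I\,|\,C]$ with identity columns labelled by the row labels $B$. -}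

module Defs where

open import Data.Nat using (ℕ)
open import Data.Fin using (Fin)
open import Data.Fin.Properties using () renaming (_≟_ to _≟ᶠ_)
open import Data.Bool using (Bool; true; false; _∨_)
open import Data.Product using (Σ; ∃; _×_; _,_)
open import Data.Sum using (_⊎_)
open import Relation.Nullary using (¬_; yes; no)
open import Relation.Binary.PropositionalEquality using (_≡_; _≢_)
open import Data.Vec.Functional using () renaming (foldr to vfoldr)

-- GF(4) = {0, 1, w, w²} with w² = w + 1

data GF4 : Set where
  𝟎 𝟏 ω₁ ω₂ : GF4

infixl 6 _⊕_
infixl 7 _⊗_

_⊕_ : GF4 → GF4 → GF4
𝟎  ⊕ y  = y
x  ⊕ 𝟎  = x
𝟏  ⊕ 𝟏  = 𝟎
𝟏  ⊕ ω₁ = ω₂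
𝟏  ⊕ ω₂ = ω₁
ω₁ ⊕ 𝟏  = ω₂
ω₁ ⊕ ω₁ = 𝟎
ω₁ ⊕ ω₂ = 𝟏
ω₂ ⊕ 𝟏  = ω₁
ω₂ ⊕ ω₁ = 𝟏
ω₂ ⊕ ω₂ = 𝟎

_⊗_ : GF4 → GF4 → GF4
𝟎  ⊗ _  = 𝟎
_  ⊗ 𝟎  = 𝟎
𝟏  ⊗ y  = y
x  ⊗ 𝟏  = x
ω₁ ⊗ ω₁ = ω₂
ω₁ ⊗ ω₂ = 𝟏
ω₂ ⊗ ω₁ = 𝟏
ω₂ ⊗ ω₂ = ω₁

ΣF : {n : ℕ} → (Fin n → GF4) → GF4
ΣF f = vfoldr _⊕_ 𝟎 f

-- Ground set E, with r = |X - e| and s = |(E - X) - f|.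

data El (r s : ℕ) : Set where
  xr : Fin r → El r s     -- elements of X - e   (row labels)
  ff : El r s             -- f                   (row label)
  ky : Fin s → El r s     -- elements of (E - X) - f (column labels)
  ee : El r s             -- e                   (column label)

-- row labels B = (X - e) ∪ f
data Row (r : ℕ) : Set where
  rx : Fin r → Row r
  rf : Row r

ΣE : {r s : ℕ} → (El r s → GF4) → GF4
ΣE g = ΣF (λ i → g (xr i)) ⊕ g ff ⊕ ΣF (λ j → g (ky j)) ⊕ g ee

-- Columns of [I | C] where C = [[A , 1],[1ᵀ , c]] (c = 0 for C, c = ω for C').
colIC : {r s : ℕ} → (Fin r → Fin s → GF4) → GF4 → El r s → Row r → GF4
colIC A c (xr i) (rx i') with i ≟ᶠ i'
... | yes _ = 𝟏
... | no  _ = 𝟎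
colIC A c (xr i) rf     = 𝟎
colIC A c ff     (rx _) = 𝟎
colIC A c ff     rf     = 𝟏
colIC A c (ky j) (rx i) = A i j
colIC A c (ky j) rf     = 𝟏
colIC A c ee     (rx _) = 𝟏
colIC A c ee     rf     = c

Subset : ℕ → ℕ → Set
Subset r s = El r s → Bool

_⊆_ : {r s : ℕ} → Subset r s → Subset r s → Set
S ⊆ T = ∀ x → S x ≡ true → T x ≡ true

_≐_ : {r s : ℕ} → Subset r s → Subset r s → Set
S ≐ T = ∀ x → S x ≡ T x

ins : {r s : ℕ} → El r s → Subset r s → Subset r s
ins y S x = S x ∨ ⌊ y ≟E x ⌋
  where
  open import Relation.Nullary.Decidable using (⌊_⌋)
  _≟E_ : {r s : ℕ} → (a b : El r s) → Relation.Nullary.Dec (a ≡ b)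
  xr i ≟E xr j with i ≟ᶠ j
  ... | yes Relation.Binary.PropositionalEquality.refl = yes Relation.Binary.PropositionalEquality.refl
  ... | no ne = no λ { Relation.Binary.PropositionalEquality.refl → ne Relation.Binary.PropositionalEquality.refl }
  xr _ ≟E ff = no λ ()
  xr _ ≟E ky _ = no λ ()
  xr _ ≟E ee = no λ ()
  ff ≟E xr _ = no λ ()
  ff ≟E ff = yes Relation.Binary.PropositionalEquality.refl
  ff ≟E ky _ = no λ ()
  ff ≟E ee = no λ ()
  ky _ ≟E xr _ = no λ ()
  ky _ ≟E ff = no λ ()
  ky i ≟E ky j with i ≟ᶠ j
  ... | yes Relation.Binary.PropositionalEquality.refl = yes Relation.Binary.PropositionalEquality.refl
  ... | no ne = no λ { Relation.Binary.PropositionalEquality.refl → ne Relation.Binary.PropositionalEquality.refl }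
  ky _ ≟E ee = no λ ()
  ee ≟E xr _ = no λ ()
  ee ≟E ff = no λ ()
  ee ≟E ky _ = no λ ()
  ee ≟E ee = yes Relation.Binary.PropositionalEquality.refl

Columns : ℕ → ℕ → Set
Columns r s = El r s → Row r → GF4

Dependent : {r s : ℕ} → Columns r s → Subset r s → Set
Dependent v S =
  Σ (_ → GF4) λ c →
    (∀ x → S x ≡ false → c x ≡ 𝟎) ×
    (∃ λ x → c x ≢ 𝟎) ×
    (∀ i → ΣE (λ x → c x ⊗ v x i) ≡ 𝟎)

Independent : {r s : ℕ} → Columns r s → Subset r s → Set
Independent v S = ¬ Dependent v S

Basis : {r s : ℕ} → Columns r s → Subset r s → Set
Basis v S = Independent v S × (∀ y → S y ≡ false → ¬ Independent v (ins y S))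

Circuit : {r s : ℕ} → Columns r s → Subset r s → Set
Circuit v S = Dependent v S ×
  (∀ T → T ⊆ S → (∃ λ x → S x ≡ true × T x ≡ false) → Independent v T)

Spanning : {r s : ℕ} → Columns r s → Subset r s → Set
Spanning v S = ∃ λ B → B ⊆ S × Basis v B

Hyperplane : {r s : ℕ} → Columns r s → Subset r s → Set
Hyperplane v S = ¬ Spanning v S × (∀ y → S y ≡ false → Spanning v (ins y S))

Xset : {r s : ℕ} → Subset r s
Xset (xr _) = true
Xset ff     = false
Xset (ky _) = false
Xset ee     = true

Bset : {r s : ℕ} → Subset r s
Bset (xr _) = true
Bset ff     = true
Bset (ky _) = false
Bset ee     = false

Has3Row : {m n : ℕ} → (Fin m → Fin n → GF4) → Set
Has3Row {m} {n} A = Σ (Fin m) λ i → Σ (Fin n) λ j₁ → Σ (Fin n) λ j₂ → Σ (Fin n) λ j₃ →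
  j₁ ≢ j₂ × j₁ ≢ j₃ × j₂ ≢ j₃ ×
  A i j₁ ≢ 𝟎 × A i j₂ ≢ 𝟎 × A i j₃ ≢ 𝟎 ×
  A i j₁ ≢ A i j₂ × A i j₁ ≢ A i j₃ × A i j₂ ≢ A i j₃

transpose : {m n : ℕ} → (Fin m → Fin n → GF4) → (Fin n → Fin m → GF4)
transpose A j i = A i j

-- Relaxing X only adds the basis X, so every basis of M is independent in M'.
-- For rows P ⊆ B and columns Q of C with |P| = |Q| ≤ 2, the set (B - P) ∪ Q is a
-- basis of M[I | C] exactly when the minor of C on P × Q is nonsingular: a nontrivial
-- solution of the system on P × Q is a dependency, and adding any further element
-- always leaves more unknowns than equations. Hence every nonsingular 1×1 or 2×2
-- minor of C stays nonsingular in C'. Applied to the minors a, [[a, 1], [1, 0]],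
-- [[a, b], [1, 1]] and [[a, 1], [b, 1]] of C, this shows that each nonzero entry a of
-- A becomes an entry a' ∈ {1, ω} of A' (a' ≠ 0 and a'ω ≠ 1), and that distinct
-- entries in a row or column of A stay distinct in A'. Three distinct nonzero
-- entries in a line of A would give three distinct elements of {1, ω}.

module Submission where

open import Defs
open import Data.Nat using (ℕ)
open import Data.Fin using (Fin)
open import Data.Product using (_×_)
open import Data.Sum using (_⊎_)
open import Relation.Nullary using (¬_)
open import Relation.Binary.PropositionalEquality using (_≢_)
open import Function.Bundles using (_⇔_)

open import Data.Bool using (true; false; not; if_then_else_)
open import Data.Bool.Properties using (∨-zeroʳ; ¬-not; not-¬)
open import Data.Empty using (⊥; ⊥-elim)
open import Data.Nat using (zero; suc)
open import Data.Fin using (zero; suc) renaming (_≟_ to _≟ᶠ_)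
open import Data.Fin.Properties using (suc-injective)
open import Data.List using (List; []; _∷_; [_])
open import Data.List.Membership.Propositional using (_∈_; _∉_)
open import Data.List.Relation.Unary.Any using (here; there; any?)
open import Data.Product using (∃; ∃₂; _,_; proj₁; proj₂)
open import Data.Sum using (inj₁; inj₂)
open import Function using (_∘_)
open import Function.Bundles using (Equivalence; mk⇔)
open import Relation.Binary.Definitions using (DecidableEquality)
open import Relation.Binary.PropositionalEquality
  using (_≡_; refl; sym; trans; cong; cong₂; subst; _≗_; module ≡-Reasoning)
open import Relation.Nullary using (Dec; yes; no; does)
open import Relation.Nullary.Decidable
  using (from-yes; map′; ¬?; dec-true; dec-false; _→-dec_; _×-dec_; _⊎-dec_)
open import Relation.Unary using (Decidable)

variable
  r s : ℕ

-- Arithmetic in GF(4), decided by enumeration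

infix 4 _≟_
_≟_ : DecidableEquality GF4
𝟎  ≟ 𝟎  = yes refl
𝟎  ≟ 𝟏  = no λ ()
𝟎  ≟ ω₁ = no λ ()
𝟎  ≟ ω₂ = no λ ()
𝟏  ≟ 𝟎  = no λ ()
𝟏  ≟ 𝟏  = yes refl
𝟏  ≟ ω₁ = no λ ()
𝟏  ≟ ω₂ = no λ ()
ω₁ ≟ 𝟎  = no λ ()
ω₁ ≟ 𝟏  = no λ ()
ω₁ ≟ ω₁ = yes refl
ω₁ ≟ ω₂ = no λ ()
ω₂ ≟ 𝟎  = no λ ()
ω₂ ≟ 𝟏  = no λ ()
ω₂ ≟ ω₁ = no λ ()
ω₂ ≟ ω₂ = yes refl

∀? : {P : GF4 → Set} → Decidable P → Dec (∀ x → P x)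
∀? P? = map′ (λ { (p₀ , p₁ , p₂ , p₃) → λ { 𝟎 → p₀ ; 𝟏 → p₁ ; ω₁ → p₂ ; ω₂ → p₃ } })
             (λ h → h 𝟎 , h 𝟏 , h ω₁ , h ω₂)
             (P? 𝟎 ×-dec P? 𝟏 ×-dec P? ω₁ ×-dec P? ω₂)

∃? : {P : GF4 → Set} → Decidable P → Dec (∃ P)
∃? P? = map′ (λ { (inj₁ p) → 𝟎 , p ; (inj₂ (inj₁ p)) → 𝟏 , p
                ; (inj₂ (inj₂ (inj₁ p))) → ω₁ , p ; (inj₂ (inj₂ (inj₂ p))) → ω₂ , p })
             (λ { (𝟎 , p) → inj₁ p ; (𝟏 , p) → inj₂ (inj₁ p)
                ; (ω₁ , p) → inj₂ (inj₂ (inj₁ p)) ; (ω₂ , p) → inj₂ (inj₂ (inj₂ p)) })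
             (P? 𝟎 ⊎-dec P? 𝟏 ⊎-dec P? ω₁ ⊎-dec P? ω₂)

⊕-assoc : ∀ x y z → x ⊕ y ⊕ z ≡ x ⊕ (y ⊕ z)
⊕-assoc = from-yes (∀? λ x → ∀? λ y → ∀? λ z → x ⊕ y ⊕ z ≟ x ⊕ (y ⊕ z))

⊕-interchange : ∀ w x y z → w ⊕ x ⊕ (y ⊕ z) ≡ w ⊕ y ⊕ (x ⊕ z)
⊕-interchange = from-yes (∀? λ w → ∀? λ x → ∀? λ y → ∀? λ z →
  w ⊕ x ⊕ (y ⊕ z) ≟ w ⊕ y ⊕ (x ⊕ z))

⊕-identityʳ : ∀ x → x ⊕ 𝟎 ≡ x
⊕-identityʳ = from-yes (∀? λ x → x ⊕ 𝟎 ≟ x)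

⊕-self : ∀ x → x ⊕ x ≡ 𝟎
⊕-self = from-yes (∀? λ x → x ⊕ x ≟ 𝟎)

⊕≡𝟎⇒≡ : ∀ x y → x ⊕ y ≡ 𝟎 → x ≡ y
⊕≡𝟎⇒≡ = from-yes (∀? λ x → ∀? λ y → x ⊕ y ≟ 𝟎 →-dec x ≟ y)

⊗-zeroʳ : ∀ x → x ⊗ 𝟎 ≡ 𝟎
⊗-zeroʳ = from-yes (∀? λ x → x ⊗ 𝟎 ≟ 𝟎)

⊗-identityʳ : ∀ x → x ⊗ 𝟏 ≡ x
⊗-identityʳ = from-yes (∀? λ x → x ⊗ 𝟏 ≟ x)

⊗-identityˡ : ∀ x → 𝟏 ⊗ x ≡ x
⊗-identityˡ = from-yes (∀? λ x → 𝟏 ⊗ x ≟ x)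

⊗-distribʳ-⊕ : ∀ x y z → (x ⊕ y) ⊗ z ≡ x ⊗ z ⊕ y ⊗ z
⊗-distribʳ-⊕ = from-yes (∀? λ x → ∀? λ y → ∀? λ z → (x ⊕ y) ⊗ z ≟ x ⊗ z ⊕ y ⊗ z)

⊗≡𝟎⇒≡𝟎 : ∀ x a → a ≢ 𝟎 → x ⊗ a ≡ 𝟎 → x ≡ 𝟎
⊗≡𝟎⇒≡𝟎 = from-yes (∀? λ x → ∀? λ a → ¬? (a ≟ 𝟎) →-dec x ⊗ a ≟ 𝟎 →-dec x ≟ 𝟎)

-- In characteristic 2 the determinant of [[a, b], [c, d]] is a d + b c.
det₂ : GF4 → GF4 → GF4 → GF4 → GF4
det₂ a b c d = a ⊗ d ⊕ b ⊗ c

nonsingular⇒trivial-kernel : ∀ a b c d x y → det₂ a b c d ≢ 𝟎 →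
  x ⊗ a ⊕ y ⊗ b ≡ 𝟎 → x ⊗ c ⊕ y ⊗ d ≡ 𝟎 → x ≡ 𝟎 × y ≡ 𝟎
nonsingular⇒trivial-kernel = from-yes (∀? λ a → ∀? λ b → ∀? λ c → ∀? λ d → ∀? λ x → ∀? λ y →
  ¬? (det₂ a b c d ≟ 𝟎) →-dec x ⊗ a ⊕ y ⊗ b ≟ 𝟎 →-dec x ⊗ c ⊕ y ⊗ d ≟ 𝟎 →-dec
  (x ≟ 𝟎 ×-dec y ≟ 𝟎))

singular⇒nontrivial-kernel : ∀ a b c d → det₂ a b c d ≡ 𝟎 →
  ∃₂ λ x y → (x ≢ 𝟎 ⊎ y ≢ 𝟎) × x ⊗ a ⊕ y ⊗ b ≡ 𝟎 × x ⊗ c ⊕ y ⊗ d ≡ 𝟎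
singular⇒nontrivial-kernel = from-yes (∀? λ a → ∀? λ b → ∀? λ c → ∀? λ d →
  det₂ a b c d ≟ 𝟎 →-dec ∃? λ x → ∃? λ y →
  (¬? (x ≟ 𝟎) ⊎-dec ¬? (y ≟ 𝟎)) ×-dec x ⊗ a ⊕ y ⊗ b ≟ 𝟎 ×-dec x ⊗ c ⊕ y ⊗ d ≟ 𝟎)

one-equation-nontrivial-kernel : ∀ a b →
  ∃₂ λ x y → (x ≢ 𝟎 ⊎ y ≢ 𝟎) × x ⊗ a ⊕ y ⊗ b ≡ 𝟎
one-equation-nontrivial-kernel = from-yes (∀? λ a → ∀? λ b → ∃? λ x → ∃? λ y →
  (¬? (x ≟ 𝟎) ⊎-dec ¬? (y ≟ 𝟎)) ×-dec x ⊗ a ⊕ y ⊗ b ≟ 𝟎)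

-- The cross product of the rows (e, a, b) and (f, c, d).
cross-product-orthogonal : ∀ e a b f c d →
  let x = det₂ a b c d ; y = b ⊗ f ⊕ e ⊗ d ; z = e ⊗ c ⊕ a ⊗ f in
  x ⊗ e ⊕ y ⊗ a ⊕ z ⊗ b ≡ 𝟎 × x ⊗ f ⊕ y ⊗ c ⊕ z ⊗ d ≡ 𝟎
cross-product-orthogonal = from-yes (∀? λ e → ∀? λ a → ∀? λ b → ∀? λ f → ∀? λ c → ∀? λ d →
  let x = det₂ a b c d ; y = b ⊗ f ⊕ e ⊗ d ; z = e ⊗ c ⊕ a ⊗ f in
  x ⊗ e ⊕ y ⊗ a ⊕ z ⊗ b ≟ 𝟎 ×-dec x ⊗ f ⊕ y ⊗ c ⊕ z ⊗ d ≟ 𝟎)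

-- Sums and the standard representation [I | C]

ΣF-cong : ∀ {n} {f g : Fin n → GF4} → f ≗ g → ΣF f ≡ ΣF g
ΣF-cong {zero}  f≗g = refl
ΣF-cong {suc n} f≗g = cong₂ _⊕_ (f≗g zero) (ΣF-cong (f≗g ∘ suc))

ΣF-zero : ∀ n → ΣF {n} (λ _ → 𝟎) ≡ 𝟎
ΣF-zero zero    = refl
ΣF-zero (suc n) = ΣF-zero n

ΣF-⊕ : ∀ {n} (f g : Fin n → GF4) → ΣF (λ k → f k ⊕ g k) ≡ ΣF f ⊕ ΣF g
ΣF-⊕ {zero}  f g = refl
ΣF-⊕ {suc n} f g =
  trans (cong (f zero ⊕ g zero ⊕_) (ΣF-⊕ (f ∘ suc) (g ∘ suc)))
        (⊕-interchange (f zero) (g zero) (ΣF (f ∘ suc)) (ΣF (g ∘ suc)))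

ΣF-single : ∀ {n} (f : Fin n → GF4) i → (∀ k → k ≢ i → f k ≡ 𝟎) → ΣF f ≡ f i
ΣF-single {suc n} f zero off =
  trans (cong (f zero ⊕_) (trans (ΣF-cong (λ k → off (suc k) λ ())) (ΣF-zero n)))
        (⊕-identityʳ (f zero))
ΣF-single {suc n} f (suc i) off =
  trans (cong (_⊕ ΣF (f ∘ suc)) (off zero λ ()))
        (ΣF-single (f ∘ suc) i (λ k k≢i → off (suc k) (k≢i ∘ suc-injective)))

-- The columns of C: those of (E - X) - f, then e.
data Col (s : ℕ) : Set where
  cy : Fin s → Col s
  ce : Col s

unit : Row r → El r s
unit (rx i) = xr i
unit rf     = ff

col : Col s → El r s
col (cy j) = ky j
col ce     = ee

El-elim : {C : El r s → Set} → (∀ p → C (unit p)) → (∀ q → C (col q)) → ∀ x → C x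
El-elim u k (xr i) = u (rx i)
El-elim u k ff     = u rf
El-elim u k (ky j) = k (cy j)
El-elim u k ee     = k ce

cy-injective : ∀ {j j' : Fin s} → cy j ≡ cy j' → j ≡ j'
cy-injective refl = refl

_≟ᴿ_ : DecidableEquality (Row r)
rx i ≟ᴿ rx i' = map′ (cong rx) (λ { refl → refl }) (i ≟ᶠ i')
rx _ ≟ᴿ rf    = no λ ()
rf   ≟ᴿ rx _  = no λ ()
rf   ≟ᴿ rf    = yes refl

_≟ᶜ_ : DecidableEquality (Col s)
cy j ≟ᶜ cy j' = map′ (cong cy) cy-injective (j ≟ᶠ j')
cy _ ≟ᶜ ce    = no λ ()
ce   ≟ᶜ cy _  = no λ ()
ce   ≟ᶜ ce    = yes refl

entry : (Fin r → Fin s → GF4) → GF4 → Col s → Row r → GF4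
entry A c q p = colIC A c (col q) p

minor₂ : (Fin r → Fin s → GF4) → GF4 → Row r → Row r → Col s → Col s → GF4
minor₂ A c p₁ p₂ q₁ q₂ =
  det₂ (entry A c q₁ p₁) (entry A c q₂ p₁) (entry A c q₁ p₂) (entry A c q₂ p₂)

ΣC : (Col s → GF4) → GF4
ΣC g = ΣF (g ∘ cy) ⊕ g ce

image : (Fin r → Fin s → GF4) → GF4 → (Col s → GF4) → Row r → GF4
image A c β p = ΣC (λ q → β q ⊗ entry A c q p)

δ : Col s → GF4 → Col s → GF4
δ q a q' = if does (q' ≟ᶜ q) then a else 𝟎

δ-same : ∀ (q : Col s) a → δ q a q ≡ a
δ-same q a = cong (if_then a else 𝟎) (dec-true (q ≟ᶜ q) refl)

δ-other : ∀ {q q' : Col s} a → q' ≢ q → δ q a q' ≡ 𝟎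
δ-other {q = q} {q'} a q'≢q = cong (if_then a else 𝟎) (dec-false (q' ≟ᶜ q) q'≢q)

variable
  A A' : Fin r → Fin s → GF4
  c c' : GF4
  β γ : Col s → GF4

ΣC-single : (g : Col s → GF4) (q : Col s) → (∀ q' → q' ≢ q → g q' ≡ 𝟎) → ΣC g ≡ g q
ΣC-single g (cy j) off =
  trans (cong₂ _⊕_ (ΣF-single (g ∘ cy) j (λ k k≢j → off (cy k) (k≢j ∘ cy-injective)))
                   (off ce λ ()))
        (⊕-identityʳ (g (cy j)))
ΣC-single {s} g ce off =
  cong (_⊕ g ce) (trans (ΣF-cong (λ j → off (cy j) λ ())) (ΣF-zero s))

ΣC-cong : {g h : Col s → GF4} → g ≗ h → ΣC g ≡ ΣC h
ΣC-cong g≗h = cong₂ _⊕_ (ΣF-cong (g≗h ∘ cy)) (g≗h ce)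

ΣC-⊕ : (g h : Col s → GF4) → ΣC (λ q → g q ⊕ h q) ≡ ΣC g ⊕ ΣC h
ΣC-⊕ g h = trans (cong (_⊕ (g ce ⊕ h ce)) (ΣF-⊕ (g ∘ cy) (h ∘ cy)))
                 (⊕-interchange (ΣF (g ∘ cy)) (ΣF (h ∘ cy)) (g ce) (h ce))

image-cong : β ≗ γ → ∀ p → image A c β p ≡ image A c γ p
image-cong {A = A} {c} β≗γ p = ΣC-cong (λ q → cong (_⊗ entry A c q p) (β≗γ q))

image-zero : ∀ p → image A c (λ _ → 𝟎) p ≡ 𝟎
image-zero {r} {s} p = cong (_⊕ 𝟎) (ΣF-zero s)

image-⊕ : ∀ (β γ : Col s → GF4) p → image A c (λ q → β q ⊕ γ q) p ≡ image A c β p ⊕ image A c γ p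
image-⊕ {A = A} {c = c} β γ p =
  trans (ΣC-cong (λ q → ⊗-distribʳ-⊕ (β q) (γ q) (entry A c q p)))
        (ΣC-⊕ (λ q → β q ⊗ entry A c q p) (λ q → γ q ⊗ entry A c q p))

image-δ : ∀ q a p → image A c (δ q a) p ≡ a ⊗ entry A c q p
image-δ {A = A} {c} q a p =
  trans (ΣC-single _ q (λ q' q'≢q → cong (_⊗ entry A c q' p) (δ-other a q'≢q)))
        (cong (_⊗ entry A c q p) (δ-same q a))

identity-diagonal : ∀ (i : Fin r) → colIC A c (xr i) (rx i) ≡ 𝟏
identity-diagonal i with i ≟ᶠ i
... | yes _   = refl
... | no i≢i = ⊥-elim (i≢i refl)

identity-off-diagonal : ∀ {k i : Fin r} → k ≢ i → colIC A c (xr k) (rx i) ≡ 𝟎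
identity-off-diagonal {k = k} {i} k≢i with k ≟ᶠ i
... | yes k≡i = ⊥-elim (k≢i k≡i)
... | no _    = refl

identity-part : (d : El r s → GF4) (p : Row r) →
  ΣF (λ k → d (xr k) ⊗ colIC A c (xr k) p) ⊕ d ff ⊗ colIC A c ff p ≡ d (unit p)
identity-part {A = A} {c} d (rx i) = begin
  ΣF (λ k → d (xr k) ⊗ colIC A c (xr k) (rx i)) ⊕ d ff ⊗ 𝟎
    ≡⟨ cong₂ _⊕_ (ΣF-single _ i off) (⊗-zeroʳ (d ff)) ⟩
  d (xr i) ⊗ colIC A c (xr i) (rx i) ⊕ 𝟎
    ≡⟨ ⊕-identityʳ _ ⟩
  d (xr i) ⊗ colIC A c (xr i) (rx i)
    ≡⟨ cong (d (xr i) ⊗_) (identity-diagonal {A = A} {c = c} i) ⟩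
  d (xr i) ⊗ 𝟏
    ≡⟨ ⊗-identityʳ (d (xr i)) ⟩
  d (xr i) ∎
  where
  open ≡-Reasoning
  off : ∀ k → k ≢ i → d (xr k) ⊗ colIC A c (xr k) (rx i) ≡ 𝟎
  off k k≢i = trans (cong (d (xr k) ⊗_) (identity-off-diagonal {A = A} {c = c} k≢i))
                    (⊗-zeroʳ (d (xr k)))
identity-part {r} d rf =
  trans (cong (_⊕ d ff ⊗ 𝟏) (trans (ΣF-cong (λ k → ⊗-zeroʳ (d (xr k)))) (ΣF-zero r)))
        (⊗-identityʳ (d ff))

ΣE-split : (d : El r s → GF4) (p : Row r) →
  ΣE (λ x → d x ⊗ colIC A c x p) ≡ d (unit p) ⊕ image A c (d ∘ col) p
ΣE-split {A = A} {c} d p =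
  trans (⊕-assoc (ΣF (λ k → d (xr k) ⊗ colIC A c (xr k) p) ⊕ d ff ⊗ colIC A c ff p) _ _)
        (cong (_⊕ image A c (d ∘ col) p) (identity-part d p))

-- Exchanging rows of B for columns of C

_∈ᴿ?_ : (p : Row r) (P : List (Row r)) → Dec (p ∈ P)
p ∈ᴿ? P = any? (p ≟ᴿ_) P

_∈ᶜ?_ : (q : Col s) (Q : List (Col s)) → Dec (q ∈ Q)
q ∈ᶜ? Q = any? (q ≟ᶜ_) Q

exchange : List (Row r) → List (Col s) → Subset r s
exchange P Q (xr i) = not (does (rx i ∈ᴿ? P))
exchange P Q ff     = not (does (rf ∈ᴿ? P))
exchange P Q (ky j) = does (cy j ∈ᶜ? Q)
exchange P Q ee     = does (ce ∈ᶜ? Q)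

variable
  p p' p₁ p₂ : Row r
  q q' q₁ q₂ q₃ : Col s
  P P' : List (Row r)
  Q : List (Col s)

exchange-unit : ∀ p → exchange {s = s} P Q (unit p) ≡ not (does (p ∈ᴿ? P))
exchange-unit (rx i) = refl
exchange-unit rf     = refl

exchange-col : ∀ q → exchange {r = r} P Q (col q) ≡ does (q ∈ᶜ? Q)
exchange-col (cy j) = refl
exchange-col ce     = refl

module _ {a} {X : Set a} where

  does≡true⇔ : (x? : Dec X) → does x? ≡ true ⇔ X
  does≡true⇔ (yes x) = mk⇔ (λ _ → x) (λ _ → refl)
  does≡true⇔ (no ¬x) = mk⇔ (λ ()) (λ x → ⊥-elim (¬x x))

  does≡false⇔ : (x? : Dec X) → does x? ≡ false ⇔ (¬ X)
  does≡false⇔ (yes x) = mk⇔ (λ ()) (λ ¬x → ⊥-elim (¬x x))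
  does≡false⇔ (no ¬x) = mk⇔ (λ _ → ¬x) (λ _ → refl)

  not-does≡false⇔ : (x? : Dec X) → not (does x?) ≡ false ⇔ X
  not-does≡false⇔ (yes x) = mk⇔ (λ _ → x) (λ _ → refl)
  not-does≡false⇔ (no ¬x) = mk⇔ (λ ()) (λ x → ⊥-elim (¬x x))

kept-row⇔ : ∀ p → exchange {s = s} P Q (unit p) ≡ true ⇔ p ∉ P
kept-row⇔ {P = P} p =
  subst (λ b → b ≡ true ⇔ p ∉ P) (sym (exchange-unit p)) (does≡true⇔ (¬? (p ∈ᴿ? P)))

removed-row⇔ : ∀ p → exchange {s = s} P Q (unit p) ≡ false ⇔ p ∈ P
removed-row⇔ {P = P} p =
  subst (λ b → b ≡ false ⇔ p ∈ P) (sym (exchange-unit p)) (not-does≡false⇔ (p ∈ᴿ? P))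

added-col⇔ : ∀ q → exchange {r = r} P Q (col q) ≡ true ⇔ q ∈ Q
added-col⇔ {Q = Q} q =
  subst (λ b → b ≡ true ⇔ q ∈ Q) (sym (exchange-col q)) (does≡true⇔ (q ∈ᶜ? Q))

absent-col⇔ : ∀ q → exchange {r = r} P Q (col q) ≡ false ⇔ q ∉ Q
absent-col⇔ {Q = Q} q =
  subst (λ b → b ≡ false ⇔ q ∉ Q) (sym (exchange-col q)) (does≡false⇔ (q ∈ᶜ? Q))

ins-self : ∀ (y : El r s) S → ins y S y ≡ true
ins-self (xr i) S with i ≟ᶠ i
... | yes refl = ∨-zeroʳ (S (xr i))
... | no i≢i   = ⊥-elim (i≢i refl)
ins-self ff     S = ∨-zeroʳ (S ff)
ins-self (ky j) S with j ≟ᶠ j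
... | yes refl = ∨-zeroʳ (S (ky j))
... | no j≢j   = ⊥-elim (j≢j refl)
ins-self ee     S = ∨-zeroʳ (S ee)

ins-⊇ : ∀ (y : El r s) S x → S x ≡ true → ins y S x ≡ true
ins-⊇ y S x Sx rewrite Sx = refl

⊆-ins : ∀ {y : El r s} {S T} → (∀ x → T x ≡ true → x ≡ y ⊎ S x ≡ true) → T ⊆ ins y S
⊆-ins {y = y} {S} h x Tx with h x Tx
... | inj₁ refl = ins-self y S
... | inj₂ Sx   = ins-⊇ y S x Sx

exchange-⊆-ins-unit : (∀ {p'} → p' ∈ P → p' ≢ p → p' ∈ P') →
  exchange P' Q ⊆ ins (unit p) (exchange P Q)
exchange-⊆-ins-unit {P = P} {p = p} {P' = P'} {Q = Q} P-p⊆P' = ⊆-ins (El-elim row column)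
  where
  row : ∀ p' → exchange P' Q (unit p') ≡ true → unit p' ≡ unit p ⊎ exchange P Q (unit p') ≡ true
  row p' kept with p' ≟ᴿ p
  ... | yes refl = inj₁ refl
  ... | no p'≢p  = inj₂ (Equivalence.from (kept-row⇔ p') λ p'∈P →
                     Equivalence.to (kept-row⇔ p') kept (P-p⊆P' p'∈P p'≢p))
  column : ∀ q → exchange P' Q (col q) ≡ true → col q ≡ unit p ⊎ exchange P Q (col q) ≡ true
  column q added = inj₂ (Equivalence.from (added-col⇔ q) (Equivalence.to (added-col⇔ q) added))

exchange-⊆-ins-col : exchange P (q ∷ Q) ⊆ ins (col q) (exchange P Q)
exchange-⊆-ins-col {P = P} {q = q} {Q = Q} = ⊆-ins (El-elim row column)
  where
  row : ∀ p → exchange P (q ∷ Q) (unit p) ≡ true → unit p ≡ col q ⊎ exchange P Q (unit p) ≡ true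
  row p kept = inj₂ (Equivalence.from (kept-row⇔ p) (Equivalence.to (kept-row⇔ p) kept))
  column : ∀ q' → exchange P (q ∷ Q) (col q') ≡ true → col q' ≡ col q ⊎ exchange P Q (col q') ≡ true
  column q' added with Equivalence.to (added-col⇔ q') added
  ... | here refl  = inj₁ refl
  ... | there q'∈Q = inj₂ (Equivalence.from (added-col⇔ q') q'∈Q)

Dependent-mono : ∀ {v : Columns r s} {S T} → S ⊆ T → Dependent v S → Dependent v T
Dependent-mono S⊆T (d , outside , nonzero , relation) =
  d , (λ x Tx≡false → outside x (¬-not (not-¬ Tx≡false ∘ S⊆T x))) , nonzero , relation

record NontrivialSolution (A : Fin r → Fin s → GF4) (c : GF4)
                          (P : List (Row r)) (Q : List (Col s)) : Set where
  field
    vector     : Col s → GF4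
    supported  : ∀ {q} → q ∉ Q → vector q ≡ 𝟎
    nontrivial : ∃ λ q → vector q ≢ 𝟎
    solves     : ∀ {p} → p ∈ P → image A c vector p ≡ 𝟎

OnlyTrivialSolution : (Fin r → Fin s → GF4) → GF4 → List (Row r) → List (Col s) → Set
OnlyTrivialSolution A c P Q =
  ∀ β → (∀ {q} → q ∉ Q → β q ≡ 𝟎) → (∀ {p} → p ∈ P → image A c β p ≡ 𝟎) →
  ∀ {q} → q ∈ Q → β q ≡ 𝟎

solution⇒dependent : NontrivialSolution A c P Q → Dependent (colIC A c) (exchange P Q)
solution⇒dependent {A = A} {c} {P} {Q} sol =
  d , outside , (col q₀ , subst (_≢ 𝟎) (sym (d-col q₀)) vector≢0) , relation
  where
  open NontrivialSolution sol
  q₀ = proj₁ nontrivial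
  vector≢0 = proj₂ nontrivial
  d : El _ _ → GF4
  d = El-elim (image A c vector) vector
  d-unit : ∀ p → d (unit p) ≡ image A c vector p
  d-unit (rx i) = refl
  d-unit rf     = refl
  d-col : ∀ q → d (col q) ≡ vector q
  d-col (cy j) = refl
  d-col ce     = refl
  outside : ∀ x → exchange P Q x ≡ false → d x ≡ 𝟎
  outside = El-elim
    (λ p removed → trans (d-unit p) (solves (Equivalence.to (removed-row⇔ p) removed)))
    (λ q absent → trans (d-col q) (supported (Equivalence.to (absent-col⇔ q) absent)))
  relation : ∀ p → ΣE (λ x → d x ⊗ colIC A c x p) ≡ 𝟎
  relation p = trans (ΣE-split d p)
                     (trans (cong (_⊕ image A c vector p) (d-unit p)) (⊕-self (image A c vector p)))

only-trivial⇒independent : OnlyTrivialSolution A c P Q → Independent (colIC A c) (exchange P Q)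
only-trivial⇒independent {A = A} {c} {P} {Q} trivial (d , outside , (x , d≢0) , relation) =
  d≢0 (d≡0 x)
  where
  d-unit : ∀ p → d (unit p) ≡ image A c (d ∘ col) p
  d-unit p = ⊕≡𝟎⇒≡ (d (unit p)) (image A c (d ∘ col) p) (trans (sym (ΣE-split d p)) (relation p))
  supported : ∀ {q} → q ∉ Q → d (col q) ≡ 𝟎
  supported {q} q∉Q = outside (col q) (Equivalence.from (absent-col⇔ q) q∉Q)
  solves : ∀ {p} → p ∈ P → image A c (d ∘ col) p ≡ 𝟎
  solves {p} p∈P = trans (sym (d-unit p)) (outside (unit p) (Equivalence.from (removed-row⇔ p) p∈P))
  d-col≡0 : ∀ q → d (col q) ≡ 𝟎
  d-col≡0 q with q ∈ᶜ? Q
  ... | yes q∈Q = trivial (d ∘ col) supported solves q∈Q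
  ... | no q∉Q  = supported q∉Q
  d≡0 : ∀ x → d x ≡ 𝟎
  d≡0 = El-elim (λ p → trans (d-unit p) (trans (image-cong d-col≡0 p) (image-zero {A = A} {c = c} p)))
                d-col≡0

exchange-basis : OnlyTrivialSolution A c P Q →
  (∀ {p} → p ∈ P → ∃ λ P' → (∀ {p'} → p' ∈ P → p' ≢ p → p' ∈ P') × NontrivialSolution A c P' Q) →
  (∀ {q} → q ∉ Q → NontrivialSolution A c P (q ∷ Q)) →
  Basis (colIC A c) (exchange P Q)
exchange-basis {A = A} {c} {P} {Q} trivial drop-row add-col =
  only-trivial⇒independent trivial , maximal
  where
  maximal : ∀ y → exchange P Q y ≡ false → ¬ Independent (colIC A c) (ins y (exchange P Q))
  maximal = El-elim
    (λ p removed independent →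
      let (P' , P-p⊆P' , sol) = drop-row (Equivalence.to (removed-row⇔ p) removed) in
      independent (Dependent-mono {v = colIC A c} (exchange-⊆-ins-unit {Q = Q} P-p⊆P')
        (solution⇒dependent sol)))
    (λ q absent independent →
      independent (Dependent-mono {v = colIC A c} (exchange-⊆-ins-col {P = P} {q = q} {Q = Q})
        (solution⇒dependent (add-col (Equivalence.to (absent-col⇔ q) absent)))))

solution₁ : ∀ {x} → x ≢ 𝟎 → (∀ {p} → p ∈ P → x ⊗ entry A c q p ≡ 𝟎) →
  NontrivialSolution A c P [ q ]
solution₁ {q = q} {x = x} x≢0 equation = record
  { vector     = δ q x
  ; supported  = λ q'∉ → δ-other x (q'∉ ∘ here)
  ; nontrivial = q , subst (_≢ 𝟎) (sym (δ-same q x)) x≢0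
  ; solves     = λ {p} p∈P → trans (image-δ q x p) (equation p∈P)
  }

solution₂ : ∀ {x y} → q₁ ≢ q₂ → x ≢ 𝟎 ⊎ y ≢ 𝟎 →
  (∀ {p} → p ∈ P → x ⊗ entry A c q₁ p ⊕ y ⊗ entry A c q₂ p ≡ 𝟎) →
  NontrivialSolution A c P (q₁ ∷ [ q₂ ])
solution₂ {q₁ = q₁} {q₂} {x = x} {y} q₁≢q₂ nonzero equation = record
  { vector     = b
  ; supported  = λ q∉ → cong₂ _⊕_ (δ-other x (q∉ ∘ here)) (δ-other y (q∉ ∘ there ∘ here))
  ; nontrivial = nontrivial nonzero
  ; solves     = λ {p} p∈P →
      trans (image-⊕ (δ q₁ x) (δ q₂ y) p)
            (trans (cong₂ _⊕_ (image-δ q₁ x p) (image-δ q₂ y p)) (equation p∈P))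
  }
  where
  b : Col _ → GF4
  b q = δ q₁ x q ⊕ δ q₂ y q
  nontrivial : x ≢ 𝟎 ⊎ y ≢ 𝟎 → ∃ λ q → b q ≢ 𝟎
  nontrivial (inj₁ x≢0) = q₁ , subst (_≢ 𝟎)
    (sym (trans (cong₂ _⊕_ (δ-same q₁ x) (δ-other y q₁≢q₂)) (⊕-identityʳ x))) x≢0
  nontrivial (inj₂ y≢0) = q₂ , subst (_≢ 𝟎)
    (sym (cong₂ _⊕_ (δ-other x (q₁≢q₂ ∘ sym)) (δ-same q₂ y))) y≢0

solution₃ : ∀ {x y z} → q₁ ≢ q₂ → q₁ ≢ q₃ → x ≢ 𝟎 →
  (∀ {p} → p ∈ P → x ⊗ entry A c q₁ p ⊕ y ⊗ entry A c q₂ p ⊕ z ⊗ entry A c q₃ p ≡ 𝟎) →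
  NontrivialSolution A c P (q₁ ∷ q₂ ∷ [ q₃ ])
solution₃ {q₁ = q₁} {q₂} {q₃} {x = x} {y} {z} q₁≢q₂ q₁≢q₃ x≢0 equation = record
  { vector     = b
  ; supported  = λ q∉ → cong₂ _⊕_ (cong₂ _⊕_ (δ-other x (q∉ ∘ here)) (δ-other y (q∉ ∘ there ∘ here)))
                                  (δ-other z (q∉ ∘ there ∘ there ∘ here))
  ; nontrivial = q₁ , subst (_≢ 𝟎) (sym b-q₁) x≢0
  ; solves     = λ {p} p∈P →
      trans (image-⊕ (λ q → δ q₁ x q ⊕ δ q₂ y q) (δ q₃ z) p)
        (trans (cong₂ _⊕_ (trans (image-⊕ (δ q₁ x) (δ q₂ y) p) (cong₂ _⊕_ (image-δ q₁ x p) (image-δ q₂ y p)))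
                          (image-δ q₃ z p))
               (equation p∈P))
  }
  where
  b : Col _ → GF4
  b q = δ q₁ x q ⊕ δ q₂ y q ⊕ δ q₃ z q
  b-q₁ : b q₁ ≡ x
  b-q₁ = trans (cong₂ _⊕_ (cong₂ _⊕_ (δ-same q₁ x) (δ-other y q₁≢q₂)) (δ-other z q₁≢q₃))
               (trans (⊕-identityʳ (x ⊕ 𝟎)) (⊕-identityʳ x))

supported₁ : (∀ {q'} → q' ∉ [ q ] → β q' ≡ 𝟎) → ∀ p → image A c β p ≡ β q ⊗ entry A c q p
supported₁ {q = q} {β = β} outside p = trans (image-cong β≗ p) (image-δ q (β q) p)
  where
  β≗ : β ≗ δ q (β q)
  β≗ q' with q' ≟ᶜ q
  ... | yes refl  = refl
  ... | no q'≢q = outside λ { (here q'≡q) → q'≢q q'≡q }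

supported₂ : q₁ ≢ q₂ → (∀ {q} → q ∉ q₁ ∷ [ q₂ ] → β q ≡ 𝟎) →
  ∀ p → image A c β p ≡ β q₁ ⊗ entry A c q₁ p ⊕ β q₂ ⊗ entry A c q₂ p
supported₂ {q₁ = q₁} {q₂} {β = β} q₁≢q₂ outside p =
  trans (image-cong β≗ p)
        (trans (image-⊕ (δ q₁ (β q₁)) (δ q₂ (β q₂)) p)
               (cong₂ _⊕_ (image-δ q₁ (β q₁) p) (image-δ q₂ (β q₂) p)))
  where
  β≗ : β ≗ λ q → δ q₁ (β q₁) q ⊕ δ q₂ (β q₂) q
  β≗ q with q ≟ᶜ q₁ | q ≟ᶜ q₂
  ... | yes refl | yes q₁≡q₂ = ⊥-elim (q₁≢q₂ q₁≡q₂)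
  ... | yes refl | no _      = sym (⊕-identityʳ (β q₁))
  ... | no _     | yes refl  = refl
  ... | no q≢q₁  | no q≢q₂   = outside λ { (here e) → q≢q₁ e ; (there (here e)) → q≢q₂ e }

one-equation-solution : q₁ ≢ q₂ → NontrivialSolution A c [ p ] (q₁ ∷ [ q₂ ])
one-equation-solution {q₁ = q₁} {q₂} {A = A} {c} {p} q₁≢q₂ =
  let (x , y , nonzero , equation) = one-equation-nontrivial-kernel (entry A c q₁ p) (entry A c q₂ p)
  in solution₂ q₁≢q₂ nonzero λ { (here refl) → equation }

singular₁ : entry A c q p ≡ 𝟎 → NontrivialSolution A c [ p ] [ q ]
singular₁ {A = A} {c} {q} {p} n≡0 =
  solution₁ {x = 𝟏} (λ ()) λ { (here refl) → trans (⊗-identityˡ (entry A c q p)) n≡0 }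

basis₁ : entry A c q p ≢ 𝟎 → Basis (colIC A c) (exchange [ p ] [ q ])
basis₁ {A = A} {c} {q} {p} n≢0 = exchange-basis trivial drop-row add-col
  where
  trivial : OnlyTrivialSolution A c [ p ] [ q ]
  trivial β outside solves (here refl) =
    ⊗≡𝟎⇒≡𝟎 (β q) (entry A c q p) n≢0 (trans (sym (supported₁ outside p)) (solves (here refl)))
  drop-row : ∀ {p'} → p' ∈ [ p ] → ∃ λ P' → (∀ {p''} → p'' ∈ [ p ] → p'' ≢ p' → p'' ∈ P') ×
                                            NontrivialSolution A c P' [ q ]
  drop-row (here refl) =
    [] , (λ { (here refl) p≢p → ⊥-elim (p≢p refl) }) , solution₁ {x = 𝟏} (λ ()) (λ ())
  add-col : ∀ {q'} → q' ∉ [ q ] → NontrivialSolution A c [ p ] (q' ∷ [ q ])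
  add-col q'∉ = one-equation-solution (q'∉ ∘ here)

singular₂ : q₁ ≢ q₂ → minor₂ A c p₁ p₂ q₁ q₂ ≡ 𝟎 →
  NontrivialSolution A c (p₁ ∷ [ p₂ ]) (q₁ ∷ [ q₂ ])
singular₂ {q₁ = q₁} {q₂} {A = A} {c} {p₁} {p₂} q₁≢q₂ det≡0 =
  let (x , y , nonzero , equation₁ , equation₂) = singular⇒nontrivial-kernel
        (entry A c q₁ p₁) (entry A c q₂ p₁) (entry A c q₁ p₂) (entry A c q₂ p₂) det≡0
  in solution₂ q₁≢q₂ nonzero λ { (here refl) → equation₁ ; (there (here refl)) → equation₂ }

basis₂ : p₁ ≢ p₂ → q₁ ≢ q₂ → minor₂ A c p₁ p₂ q₁ q₂ ≢ 𝟎 →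
  Basis (colIC A c) (exchange (p₁ ∷ [ p₂ ]) (q₁ ∷ [ q₂ ]))
basis₂ {p₁ = p₁} {p₂} {q₁ = q₁} {q₂} {A = A} {c} p₁≢p₂ q₁≢q₂ det≢0 =
  exchange-basis trivial drop-row add-col
  where
  N : Col _ → Row _ → GF4
  N = entry A c
  trivial : OnlyTrivialSolution A c (p₁ ∷ [ p₂ ]) (q₁ ∷ [ q₂ ])
  trivial β outside solves q∈Q = coordinate q∈Q
    where
    equation : ∀ {p} → p ∈ p₁ ∷ [ p₂ ] → β q₁ ⊗ N q₁ p ⊕ β q₂ ⊗ N q₂ p ≡ 𝟎
    equation p∈P = trans (sym (supported₂ q₁≢q₂ outside _)) (solves p∈P)
    β≡0 = nonsingular⇒trivial-kernel (N q₁ p₁) (N q₂ p₁) (N q₁ p₂) (N q₂ p₂) (β q₁) (β q₂)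
            det≢0 (equation (here refl)) (equation (there (here refl)))
    coordinate : ∀ {q} → q ∈ q₁ ∷ [ q₂ ] → β q ≡ 𝟎
    coordinate (here refl)         = proj₁ β≡0
    coordinate (there (here refl)) = proj₂ β≡0
  drop-row : ∀ {p} → p ∈ p₁ ∷ [ p₂ ] → ∃ λ P' → (∀ {p'} → p' ∈ p₁ ∷ [ p₂ ] → p' ≢ p → p' ∈ P') ×
                                                NontrivialSolution A c P' (q₁ ∷ [ q₂ ])
  drop-row (here refl) =
    [ p₂ ] , (λ { (here refl) p≢p → ⊥-elim (p≢p refl) ; (there p'∈) _ → p'∈ }) ,
    one-equation-solution q₁≢q₂
  drop-row (there (here refl)) =
    [ p₁ ] , (λ { (here refl) _ → here refl ; (there (here refl)) p≢p → ⊥-elim (p≢p refl) }) ,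
    one-equation-solution q₁≢q₂
  add-col : ∀ {q} → q ∉ q₁ ∷ [ q₂ ] → NontrivialSolution A c (p₁ ∷ [ p₂ ]) (q ∷ q₁ ∷ [ q₂ ])
  add-col {q} q∉ = solution₃ {y = y} {z} (q∉ ∘ here) (q∉ ∘ there ∘ here) det≢0
    λ { (here refl) → proj₁ orthogonal ; (there (here refl)) → proj₂ orthogonal }
    where
    y = N q₂ p₁ ⊗ N q p₂ ⊕ N q p₁ ⊗ N q₂ p₂
    z = N q p₁ ⊗ N q₁ p₂ ⊕ N q₁ p₁ ⊗ N q p₂
    orthogonal = cross-product-orthogonal
      (N q p₁) (N q₁ p₁) (N q₂ p₁) (N q p₂) (N q₁ p₂) (N q₂ p₂)

-- Nonsingular minors of C stay nonsingular in C'

Preserves-bases : Columns r s → Columns r s → Set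
Preserves-bases v v' = ∀ S → Basis v S → Independent v' S

transfer₁ : Preserves-bases (colIC A c) (colIC A' c') → ∀ q p →
  entry A c q p ≢ 𝟎 → entry A' c' q p ≢ 𝟎
transfer₁ preserves q p n≢0 n'≡0 =
  preserves _ (basis₁ {q = q} {p = p} n≢0) (solution⇒dependent (singular₁ {q = q} {p = p} n'≡0))

transfer₂ : Preserves-bases (colIC A c) (colIC A' c') → ∀ p₁ p₂ q₁ q₂ → p₁ ≢ p₂ → q₁ ≢ q₂ →
  minor₂ A c p₁ p₂ q₁ q₂ ≢ 𝟎 → minor₂ A' c' p₁ p₂ q₁ q₂ ≢ 𝟎
transfer₂ preserves p₁ p₂ q₁ q₂ p₁≢p₂ q₁≢q₂ det≢0 det'≡0 =
  preserves _ (basis₂ p₁≢p₂ q₁≢q₂ det≢0) (solution⇒dependent (singular₂ q₁≢q₂ det'≡0))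

det₂[a110]≢0 : ∀ a → det₂ a 𝟏 𝟏 𝟎 ≢ 𝟎
det₂[a110]≢0 = from-yes (∀? λ a → ¬? (det₂ a 𝟏 𝟏 𝟎 ≟ 𝟎))

-- a ω + 1 ≠ 0 says a ≠ ω⁻¹ = ω², the third nonzero element.
det₂[a11ω]≢0⇒a≡1⊎a≡ω : ∀ {ω a} → ω ≢ 𝟎 → ω ≢ 𝟏 → a ≢ 𝟎 → det₂ a 𝟏 𝟏 ω ≢ 𝟎 → a ≡ 𝟏 ⊎ a ≡ ω
det₂[a11ω]≢0⇒a≡1⊎a≡ω {ω} {a} = from-yes (∀? λ ω → ∀? λ a →
  ¬? (ω ≟ 𝟎) →-dec ¬? (ω ≟ 𝟏) →-dec ¬? (a ≟ 𝟎) →-dec ¬? (det₂ a 𝟏 𝟏 ω ≟ 𝟎) →-dec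
  (a ≟ 𝟏 ⊎-dec a ≟ ω)) ω a

det₂[xy11]≡0⇔x≡y : ∀ x y → det₂ x y 𝟏 𝟏 ≡ 𝟎 ⇔ x ≡ y
det₂[xy11]≡0⇔x≡y x y = mk⇔
  (from-yes (∀? λ x → ∀? λ y → det₂ x y 𝟏 𝟏 ≟ 𝟎 →-dec x ≟ y) x y)
  (from-yes (∀? λ x → ∀? λ y → x ≟ y →-dec det₂ x y 𝟏 𝟏 ≟ 𝟎) x y)

det₂[x1y1]≡0⇔x≡y : ∀ x y → det₂ x 𝟏 y 𝟏 ≡ 𝟎 ⇔ x ≡ y
det₂[x1y1]≡0⇔x≡y x y = mk⇔
  (from-yes (∀? λ x → ∀? λ y → det₂ x 𝟏 y 𝟏 ≟ 𝟎 →-dec x ≟ y) x y)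
  (from-yes (∀? λ x → ∀? λ y → x ≟ y →-dec det₂ x 𝟏 y 𝟏 ≟ 𝟎) x y)

no-three-distinct-in-pair : ∀ {a} {X : Set a} {u v x y z : X} →
  x ≡ u ⊎ x ≡ v → y ≡ u ⊎ y ≡ v → z ≡ u ⊎ z ≡ v → x ≢ y → x ≢ z → y ≢ z → ⊥
no-three-distinct-in-pair (inj₁ refl) (inj₁ refl) _           x≢y _   _   = x≢y refl
no-three-distinct-in-pair (inj₂ refl) (inj₂ refl) _           x≢y _   _   = x≢y refl
no-three-distinct-in-pair (inj₁ refl) (inj₂ refl) (inj₁ refl) _   x≢z _   = x≢z refl
no-three-distinct-in-pair (inj₁ refl) (inj₂ refl) (inj₂ refl) _   _   y≢z = y≢z refl
no-three-distinct-in-pair (inj₂ refl) (inj₁ refl) (inj₁ refl) _   _   y≢z = y≢z refl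
no-three-distinct-in-pair (inj₂ refl) (inj₁ refl) (inj₂ refl) _   x≢z _   = x≢z refl

lemma6p5 : (r s : ℕ) (A A' : Fin r → Fin s → GF4) (w : GF4) →
    w ≢ 𝟎 → w ≢ 𝟏 →
    Circuit (colIC A 𝟎) Xset → Hyperplane (colIC A 𝟎) Xset →
    Basis (colIC A 𝟎) Bset →
    (∀ S → Basis (colIC A' w) S ⇔ (Basis (colIC A 𝟎) S ⊎ S ≐ Xset)) →
    ¬ Has3Row A × ¬ Has3Row (transpose A)
lemma6p5 r s A A' w w≢0 w≢1 _ _ _ bases = no-row-triple , no-column-triple
  where
  preserves : Preserves-bases (colIC A 𝟎) (colIC A' w)
  preserves S basis = proj₁ (Equivalence.from (bases S) (inj₁ basis))

  nonzero-entry : ∀ {i j} → A i j ≢ 𝟎 → A' i j ≡ 𝟏 ⊎ A' i j ≡ w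
  nonzero-entry {i} {j} a≢0 = det₂[a11ω]≢0⇒a≡1⊎a≡ω w≢0 w≢1
    (transfer₁ preserves (cy j) (rx i) a≢0)
    (transfer₂ preserves (rx i) rf (cy j) ce (λ ()) (λ ()) (det₂[a110]≢0 (A i j)))

  row-distinct : ∀ {i j₁ j₂} → A i j₁ ≢ A i j₂ → A' i j₁ ≢ A' i j₂
  row-distinct {i} {j₁} {j₂} a₁≢a₂ a₁'≡a₂' =
    transfer₂ preserves (rx i) rf (cy j₁) (cy j₂) (λ ()) (λ { refl → a₁≢a₂ refl })
      (a₁≢a₂ ∘ Equivalence.to (det₂[xy11]≡0⇔x≡y _ _))
      (Equivalence.from (det₂[xy11]≡0⇔x≡y _ _) a₁'≡a₂')

  column-distinct : ∀ {i₁ i₂ j} → A i₁ j ≢ A i₂ j → A' i₁ j ≢ A' i₂ j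
  column-distinct {i₁} {i₂} {j} a₁≢a₂ a₁'≡a₂' =
    transfer₂ preserves (rx i₁) (rx i₂) (cy j) ce (λ { refl → a₁≢a₂ refl }) (λ ())
      (a₁≢a₂ ∘ Equivalence.to (det₂[x1y1]≡0⇔x≡y _ _))
      (Equivalence.from (det₂[x1y1]≡0⇔x≡y _ _) a₁'≡a₂')

  no-row-triple : ¬ Has3Row A
  no-row-triple (i , j₁ , j₂ , j₃ , _ , _ , _ , a₁≢0 , a₂≢0 , a₃≢0 , a₁≢a₂ , a₁≢a₃ , a₂≢a₃) =
    no-three-distinct-in-pair (nonzero-entry a₁≢0) (nonzero-entry a₂≢0) (nonzero-entry a₃≢0)
      (row-distinct a₁≢a₂) (row-distinct a₁≢a₃) (row-distinct a₂≢a₃)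

  no-column-triple : ¬ Has3Row (transpose A)
  no-column-triple (j , i₁ , i₂ , i₃ , _ , _ , _ , a₁≢0 , a₂≢0 , a₃≢0 , a₁≢a₂ , a₁≢a₃ , a₂≢a₃) =
    no-three-distinct-in-pair (nonzero-entry a₁≢0) (nonzero-entry a₂≢0) (nonzero-entry a₃≢0)
      (column-distinct a₁≢a₂) (column-distinct a₁≢a₃) (column-distinct a₂≢a₃)
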